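{- Let $\mathrm{B}_n$ be the Boolean lattice of subsets of an $n$-element set. Then the Jacobi coefficients of the radial compression of its lattice Hamiltonian are $\beta_k=\tfrac12\sqrt{(k+1)(n-k)}$ for $0\le k\le n-1$.
   Context: For a finite geometric lattice $L$ of rank $r$, $\mathbb{R}[L]$ has orthonormal basis $\{e_x:x\in L\}$. The diamond product is given on basis elements by $x\diamond y=x\vee y$ if $x\wedge y=\hat0$ (bottom) and $0$ otherwise. For an atom $a$, $L_a(x)=a\diamond x$, $L_a^t$ is its transpose, and the lattice Hamiltonian is $H=\sum_{a\text{ atom}}(L_a+L_a^t)/2$. With $L_k$ the rank-$k$ elements, $n_k=|L_k|$ and $\rho_k=n_k^{ -1/2}\sum_{x\in L_k}e_x$, the Jacobi coefficients are $\beta_k=\langle\rho_k,H\rho_{k+1}\rangle$, $0\le k\le r-1$ (so the compression of $H$ to $\operatorname{span}\{\rho_k\}$ satisfies $\rho_k\mapsto\beta_{k-1}\rho_{k-1}+\beta_k\rho_{k+1}$). -}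

module Defs where

open import Level using (Level; _⊔_)
open import Data.Nat as ℕ using (ℕ; zero; suc)
open import Data.Bool using (Bool; true; false; _∧_; if_then_else_)
import Data.Bool.Properties as BoolP
open import Data.List using (List; []; _∷_; _++_; map; filter; length; foldr)
open import Data.Vec using (Vec; []; _∷_)
open import Data.Vec.Properties using (≡-dec)
open import Data.Fin.Subset using (Subset; _∩_; _∪_; ⊥; ∣_∣)
open import Relation.Nullary using (¬_; does)
open import Relation.Binary.Structures using (IsTotalOrder)
open import Relation.Binary.PropositionalEquality using (_≡_)
open import Algebra.Bundles using (CommutativeRing)

-- Scalars: an ordered field in which every nonnegative element has a
-- square root (a "Euclidean field"; ℝ is the intended model).
-- The inverse is total, with x * x⁻¹ ≈ 1 required only for x ≉ 0.

record EuclideanField (c ℓ₁ ℓ₂ : Level) : Set (Level.suc (c ⊔ ℓ₁ ⊔ ℓ₂)) where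
  field
    commutativeRing : CommutativeRing c ℓ₁
  open CommutativeRing commutativeRing public
  field
    _≤_          : Carrier → Carrier → Set ℓ₂
    isTotalOrder : IsTotalOrder _≈_ _≤_
    +-monoˡ-≤    : ∀ {x y} z → x ≤ y → (x + z) ≤ (y + z)
    *-nonneg     : ∀ {x y} → 0# ≤ x → 0# ≤ y → 0# ≤ (x * y)
    0≉1          : ¬ (0# ≈ 1#)
    _⁻¹          : Carrier → Carrier
    ⁻¹-cong      : ∀ {x y} → x ≈ y → (x ⁻¹) ≈ (y ⁻¹)
    ⁻¹-inverse   : ∀ x → ¬ (x ≈ 0#) → (x * (x ⁻¹)) ≈ 1#
    √            : Carrier → Carrier
    √-cong       : ∀ {x y} → x ≈ y → √ x ≈ √ y
    √-nonneg     : ∀ x → 0# ≤ √ x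
    √-square     : ∀ x → 0# ≤ x → (√ x * √ x) ≈ x

-- The Boolean lattice B_n : subsets of Fin n (join = ∪, meet = ∩,
-- bottom = ∅, rank = cardinality).

B : ℕ → Set
B n = Subset n

allSubsets : (n : ℕ) → List (Subset n)
allSubsets zero    = [] ∷ []
allSubsets (suc n) = map (true ∷_) (allSubsets n) ++ map (false ∷_) (allSubsets n)

_≟B_ : ∀ {n} (x y : Subset n) → Bool
x ≟B y = does (≡-dec BoolP._≟_ x y)

rank : ∀ {n} → Subset n → ℕ
rank x = ∣ x ∣

level : (n k : ℕ) → List (Subset n)
level n k = filter (λ x → rank x ℕ.≟ k) (allSubsets n)

atoms : (n : ℕ) → List (Subset n)
atoms n = level n 1

module LatticeHamiltonian {c ℓ₁ ℓ₂} (F : EuclideanField c ℓ₁ ℓ₂) (n : ℕ) where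
  open EuclideanField F

  Vect : Set c
  Vect = Subset n → Carrier

  Σ[_]_ : List (Subset n) → (Subset n → Carrier) → Carrier
  Σ[ xs ] f = foldr (λ x acc → f x + acc) 0# xs

  fromℕ : ℕ → Carrier
  fromℕ zero    = 0#
  fromℕ (suc m) = 1# + fromℕ m

  half : Carrier
  half = (1# + 1#) ⁻¹

  e : Subset n → Vect
  e x y = if x ≟B y then 1# else 0#

  _·_ : Carrier → Vect → Vect
  (s · v) y = s * v y

  _⊕_ : Vect → Vect → Vect
  (u ⊕ v) y = u y + v y

  zeroV : Vect
  zeroV _ = 0#

  sumV : List (Subset n) → (Subset n → Vect) → Vect
  sumV xs f = foldr (λ x acc → f x ⊕ acc) zeroV xs

  ⟨_,_⟩ : Vect → Vect → Carrier
  ⟨ u , v ⟩ = Σ[ allSubsets n ] (λ x → u x * v x)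

  -- matrix entry ⟨e_z , L_a e_x⟩ : 1 iff a ∧ x = 0̂ and a ∨ x = z
  -- (diamond product a ⋄ x = a ∨ x if a ∧ x = 0̂, else 0)
  diamond : Subset n → Subset n → Subset n → Carrier
  diamond a x z = if ((a ∩ x) ≟B ⊥) ∧ ((a ∪ x) ≟B z) then 1# else 0#

  L : Subset n → Vect → Vect
  L a v z = Σ[ allSubsets n ] (λ x → diamond a x z * v x)

  Lᵗ : Subset n → Vect → Vect
  Lᵗ a v x = Σ[ allSubsets n ] (λ z → diamond a x z * v z)

  H : Vect → Vect
  H v = sumV (atoms n) (λ a → half · (L a v ⊕ Lᵗ a v))

  nₖ : ℕ → ℕ
  nₖ k = length (level n k)

  ρ : ℕ → Vect
  ρ k = (√ (fromℕ (nₖ k)) ⁻¹) · sumV (level n k) e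

  β : ℕ → Carrier
  β k = ⟨ ρ k , H (ρ (suc k)) ⟩

-- Work pointwise: ρ_k(x) = n_k^{-1/2} [|x| = k], and for |x| = k the term L_a ρ_{k+1} vanishes at x
-- (L_a raises rank) while (L_aᵗ ρ_{k+1})(x) = n_{k+1}^{-1/2} [a ∩ x = ∅]. Exactly n − k atoms are
-- disjoint from x, so β_k = ½ (n_k n_{k+1})^{-1/2} n_k (n − k). Since n_k = C(n,k), the absorption
-- identity n_k (n − k) = n_{k+1} (k + 1) turns this into ½ √((k + 1)(n − k)). All counting is done in
-- ℕ and transported to the field along fromℕ.

module Submission where

open import Defs
open import Level using (Level)
open import Data.Nat as ℕ using (ℕ; zero; suc; _∸_; _<_)
import Data.Nat.Properties as ℕ
open import Data.Nat.Tactic.RingSolver using (solve-∀)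
open import Data.Bool using (Bool; true; false; _∧_; if_then_else_)
open import Data.List using ([]; _∷_)
open import Data.Sum using (inj₁; inj₂)
open import Data.Fin.Subset using (Subset; _∪_)
open import Relation.Nullary using (¬_)
import Relation.Binary.PropositionalEquality as ≡
open import Relation.Binary.Structures using (IsTotalOrder)
open import Algebra.Bundles using (AbelianGroup)
import Algebra.Properties.CommutativeSemigroup as CommutativeSemigroupProperties
import Algebra.Properties.Group as GroupProperties
import Algebra.Properties.Ring as RingProperties
import Relation.Binary.Reasoning.Setoid as SetoidReasoning

module Counting where

  import Data.Bool.Properties as Bool
  open import Data.List using (List; _++_; map; filter; length)
  open import Data.Vec using ([]; _∷_)
  open import Data.Vec.Properties using (≡-dec)
  open import Data.Fin.Subset using (_∩_; ⊥)
  open import Data.Nat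
  open import Data.Nat.Properties
  open import Data.Nat.Combinatorics using (_C_; nC1≡n; nCk+nC[k+1]≡[n+1]C[k+1])
  open import Relation.Nullary using (Dec; does; yes; no; contradiction)
  open import Relation.Nullary.Decidable using (dec-true; dec-false)
  open import Relation.Unary using (Decidable)
  open import Relation.Binary.PropositionalEquality
  open ≡-Reasoning

  ⟦_⟧ : Bool → ℕ
  ⟦ true ⟧  = 1
  ⟦ false ⟧ = 0

  ⟦does⟧*-cong : ∀ {P : Set} (P? : Dec P) {m n} → (P → m ≡ n) → ⟦ does P? ⟧ * m ≡ ⟦ does P? ⟧ * n
  ⟦does⟧*-cong (yes p) m≡n = cong (_+ 0) (m≡n p)
  ⟦does⟧*-cong (no _)  _   = refl

  ∑ℕ : {A : Set} → List A → (A → ℕ) → ℕ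
  ∑ℕ []       f = 0
  ∑ℕ (x ∷ xs) f = f x + ∑ℕ xs f

  module _ {A : Set} where

    ∑ℕ-++ : ∀ (xs ys : List A) f → ∑ℕ (xs ++ ys) f ≡ ∑ℕ xs f + ∑ℕ ys f
    ∑ℕ-++ []       ys f = refl
    ∑ℕ-++ (x ∷ xs) ys f = trans (cong (f x +_) (∑ℕ-++ xs ys f)) (sym (+-assoc (f x) _ _))

    ∑ℕ-map : ∀ {B : Set} (g : A → B) xs f → ∑ℕ (map g xs) f ≡ ∑ℕ xs (λ x → f (g x))
    ∑ℕ-map g []       f = refl
    ∑ℕ-map g (x ∷ xs) f = cong (f (g x) +_) (∑ℕ-map g xs f)

    ∑ℕ-cong : ∀ xs {f g : A → ℕ} → (∀ x → f x ≡ g x) → ∑ℕ xs f ≡ ∑ℕ xs g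
    ∑ℕ-cong []       f≡g = refl
    ∑ℕ-cong (x ∷ xs) f≡g = cong₂ _+_ (f≡g x) (∑ℕ-cong xs f≡g)

    ∑ℕ-zero : ∀ xs {f : A → ℕ} → (∀ x → f x ≡ 0) → ∑ℕ xs f ≡ 0
    ∑ℕ-zero []       f≡0 = refl
    ∑ℕ-zero (x ∷ xs) f≡0 = cong₂ _+_ (f≡0 x) (∑ℕ-zero xs f≡0)

    ∑ℕ-*ʳ : ∀ xs (f : A → ℕ) m → ∑ℕ xs (λ x → f x * m) ≡ ∑ℕ xs f * m
    ∑ℕ-*ʳ []       f m = refl
    ∑ℕ-*ʳ (x ∷ xs) f m = trans (cong (f x * m +_) (∑ℕ-*ʳ xs f m)) (sym (*-distribʳ-+ m (f x) _))

    module _ {P : A → Set} (P? : Decidable P) where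

      ∑ℕ-filter : ∀ xs f → ∑ℕ (filter P? xs) f ≡ ∑ℕ xs (λ x → ⟦ does (P? x) ⟧ * f x)
      ∑ℕ-filter []       f = refl
      ∑ℕ-filter (x ∷ xs) f with does (P? x)
      ... | true  = cong₂ _+_ (sym (+-identityʳ (f x))) (∑ℕ-filter xs f)
      ... | false = ∑ℕ-filter xs f

      length-filter≡∑ℕ : ∀ xs → length (filter P? xs) ≡ ∑ℕ xs (λ x → ⟦ does (P? x) ⟧)
      length-filter≡∑ℕ []       = refl
      length-filter≡∑ℕ (x ∷ xs) with does (P? x)
      ... | true  = cong suc (length-filter≡∑ℕ xs)
      ... | false = length-filter≡∑ℕ xs

  ∑ℕ-allSubsets-suc : ∀ n (f : Subset (suc n) → ℕ) →
    ∑ℕ (allSubsets (suc n)) f ≡ ∑ℕ (allSubsets n) (λ x → f (true ∷ x)) + ∑ℕ (allSubsets n) (λ x → f (false ∷ x))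
  ∑ℕ-allSubsets-suc n f = trans (∑ℕ-++ (map (true ∷_) (allSubsets n)) _ f)
    (cong₂ _+_ (∑ℕ-map _ (allSubsets n) f) (∑ℕ-map _ (allSubsets n) f))

  ∑ℕ-allSubsets-δ : ∀ n (x : Subset n) (g : Subset n → ℕ) → ∑ℕ (allSubsets n) (λ y → ⟦ x ≟B y ⟧ * g y) ≡ g x
  ∑ℕ-allSubsets-δ zero    []          g = trans (+-identityʳ _) (+-identityʳ _)
  ∑ℕ-allSubsets-δ (suc n) (true ∷ x)  g = begin
    ∑ℕ (allSubsets (suc n)) (λ y → ⟦ (true ∷ x) ≟B y ⟧ * g y)  ≡⟨ ∑ℕ-allSubsets-suc n _ ⟩
    _ + ∑ℕ (allSubsets n) (λ _ → 0)                          ≡⟨ cong₂ _+_ (∑ℕ-allSubsets-δ n x _) (∑ℕ-zero (allSubsets n) λ _ → refl) ⟩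
    g (true ∷ x) + 0                                          ≡⟨ +-identityʳ _ ⟩
    g (true ∷ x)                                              ∎
  ∑ℕ-allSubsets-δ (suc n) (false ∷ x) g = trans (∑ℕ-allSubsets-suc n _)
    (cong₂ _+_ (∑ℕ-zero (allSubsets n) λ _ → refl) (∑ℕ-allSubsets-δ n x _))

  ≟B-sym : ∀ {n} (x y : Subset n) → x ≟B y ≡ y ≟B x
  ≟B-sym x y with ≡-dec Bool._≟_ x y | ≡-dec Bool._≟_ y x
  ... | yes _   | yes _   = refl
  ... | no _    | no _    = refl
  ... | yes x≡y | no y≢x  = contradiction (sym x≡y) y≢x
  ... | no x≢y  | yes y≡x = contradiction (sym y≡x) x≢y

  ≟B-sound : ∀ {n} (x y : Subset n) → x ≟B y ≡ true → x ≡ y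
  ≟B-sound x y eq with ≡-dec Bool._≟_ x y
  ... | yes x≡y = x≡y

  isRank : ∀ {n} → ℕ → Subset n → ℕ
  isRank k x = ⟦ does (rank x ≟ k) ⟧

  ∑ℕ-level-δ : ∀ n j (x : Subset n) → ∑ℕ (level n j) (λ a → ⟦ a ≟B x ⟧) ≡ isRank j x
  ∑ℕ-level-δ n j x = begin
    ∑ℕ (level n j) (λ a → ⟦ a ≟B x ⟧)                 ≡⟨ ∑ℕ-filter (λ a → rank a ≟ j) (allSubsets n) _ ⟩
    ∑ℕ (allSubsets n) (λ a → isRank j a * ⟦ a ≟B x ⟧)  ≡⟨ ∑ℕ-cong (allSubsets n) swap ⟩
    ∑ℕ (allSubsets n) (λ a → ⟦ x ≟B a ⟧ * isRank j a)  ≡⟨ ∑ℕ-allSubsets-δ n x (isRank j) ⟩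
    isRank j x                                          ∎
    where
    swap : ∀ a → isRank j a * ⟦ a ≟B x ⟧ ≡ ⟦ x ≟B a ⟧ * isRank j a
    swap a = trans (*-comm (isRank j a) _) (cong (λ b → ⟦ b ⟧ * isRank j a) (≟B-sym a x))

  length-level≡∑ℕ : ∀ n k → length (level n k) ≡ ∑ℕ (allSubsets n) (isRank k)
  length-level≡∑ℕ n k = length-filter≡∑ℕ (λ x → rank x ≟ k) (allSubsets n)

  disjoint : ∀ {n} → Subset n → Subset n → Bool
  disjoint a x = (a ∩ x) ≟B ⊥

  rank-∪-disjoint : ∀ {n} (a x : Subset n) → disjoint a x ≡ true → rank (a ∪ x) ≡ rank a + rank x
  rank-∪-disjoint []          []          _  = refl
  rank-∪-disjoint (true ∷ a)  (true ∷ x)  ()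
  rank-∪-disjoint (true ∷ a)  (false ∷ x) eq = cong suc (rank-∪-disjoint a x eq)
  rank-∪-disjoint (false ∷ a) (true ∷ x)  eq = trans (cong suc (rank-∪-disjoint a x eq)) (sym (+-suc _ _))
  rank-∪-disjoint (false ∷ a) (false ∷ x) eq = rank-∪-disjoint a x eq

  ∑ℕ-disjoint-rank0≡1 : ∀ n (x : Subset n) → ∑ℕ (allSubsets n) (λ a → isRank 0 a * ⟦ disjoint a x ⟧) ≡ 1
  ∑ℕ-disjoint-rank0≡1 zero    []      = refl
  ∑ℕ-disjoint-rank0≡1 (suc n) (_ ∷ x) = trans (∑ℕ-allSubsets-suc n _)
    (cong₂ _+_ (∑ℕ-zero (allSubsets n) λ _ → refl) (∑ℕ-disjoint-rank0≡1 n x))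

  ∑ℕ-disjoint-atoms+rank≡n : ∀ n (x : Subset n) → ∑ℕ (allSubsets n) (λ a → isRank 1 a * ⟦ disjoint a x ⟧) + rank x ≡ n
  ∑ℕ-disjoint-atoms+rank≡n zero    []          = refl
  ∑ℕ-disjoint-atoms+rank≡n (suc n) (true ∷ x)  = begin
    ∑ℕ (allSubsets (suc n)) (λ a → isRank 1 a * ⟦ disjoint a (true ∷ x) ⟧) + suc (rank x)
      ≡⟨ cong (_+ suc (rank x)) (∑ℕ-allSubsets-suc n _) ⟩
    (∑ℕ (allSubsets n) (λ a → isRank 0 a * 0) + count₁) + suc (rank x)
      ≡⟨ cong (λ m → m + count₁ + suc (rank x)) (∑ℕ-zero (allSubsets n) λ a → *-zeroʳ (isRank 0 a)) ⟩
    count₁ + suc (rank x)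
      ≡⟨ +-suc count₁ (rank x) ⟩
    suc (count₁ + rank x)
      ≡⟨ cong suc (∑ℕ-disjoint-atoms+rank≡n n x) ⟩
    suc n ∎
    where count₁ = ∑ℕ (allSubsets n) (λ a → isRank 1 a * ⟦ disjoint a x ⟧)
  ∑ℕ-disjoint-atoms+rank≡n (suc n) (false ∷ x) = begin
    ∑ℕ (allSubsets (suc n)) (λ a → isRank 1 a * ⟦ disjoint a (false ∷ x) ⟧) + rank x
      ≡⟨ cong (_+ rank x) (∑ℕ-allSubsets-suc n _) ⟩
    (∑ℕ (allSubsets n) (λ a → isRank 0 a * ⟦ disjoint a x ⟧) + count₁) + rank x
      ≡⟨ cong (λ m → m + count₁ + rank x) (∑ℕ-disjoint-rank0≡1 n x) ⟩
    suc (count₁ + rank x)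
      ≡⟨ cong suc (∑ℕ-disjoint-atoms+rank≡n n x) ⟩
    suc n ∎
    where count₁ = ∑ℕ (allSubsets n) (λ a → isRank 1 a * ⟦ disjoint a x ⟧)

  -- With s = n_{k+1}^{-1/2}: (L_a ρ_{k+1})(x) = s · L-count k a x, (L_aᵗ ρ_{k+1})(x) = s · Lᵗ-count k a x
  -- and (H ρ_{k+1})(x) = (s/2) · Hρ-count k x.
  L-count : ∀ {n} → ℕ → Subset n → Subset n → ℕ
  L-count {n} k a x = ∑ℕ (allSubsets n) (λ y → ⟦ disjoint a y ∧ ((a ∪ y) ≟B x) ⟧ * isRank (suc k) y)

  Lᵗ-count : ∀ {n} → ℕ → Subset n → Subset n → ℕ
  Lᵗ-count {n} k a x = ∑ℕ (allSubsets n) (λ z → ⟦ disjoint a x ∧ ((a ∪ x) ≟B z) ⟧ * isRank (suc k) z)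

  Hρ-count : ∀ {n} → ℕ → Subset n → ℕ
  Hρ-count {n} k x = ∑ℕ (atoms n) (λ a → L-count k a x + Lᵗ-count k a x)

  L-count-on-level : ∀ {n} k (a x : Subset n) → rank x ≡ k → L-count k a x ≡ 0
  L-count-on-level {n} k a x rx = ∑ℕ-zero (allSubsets n) term
    where
    term : ∀ y → ⟦ disjoint a y ∧ ((a ∪ y) ≟B x) ⟧ * isRank (suc k) y ≡ 0
    term y with disjoint a y in d | (a ∪ y) ≟B x in u
    ... | false | _     = refl
    ... | true  | false = refl
    ... | true  | true  = cong (λ b → ⟦ b ⟧ + 0) (dec-false (rank y ≟ suc k) rank[y]≢1+k)
      where
      rank[y]≢1+k : rank y ≢ suc k
      rank[y]≢1+k ry = m≢1+n+m k (begin
        k                    ≡⟨ sym rx ⟩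
        rank x               ≡⟨ cong rank (sym (≟B-sound (a ∪ y) x u)) ⟩
        rank (a ∪ y)         ≡⟨ rank-∪-disjoint a y d ⟩
        rank a + rank y      ≡⟨ cong (rank a +_) ry ⟩
        rank a + suc k       ≡⟨ +-suc (rank a) k ⟩
        suc (rank a + k)     ∎)

  Lᵗ-count-on-level : ∀ {n} k (a x : Subset n) → rank a ≡ 1 → rank x ≡ k → Lᵗ-count k a x ≡ ⟦ disjoint a x ⟧
  Lᵗ-count-on-level {n} k a x ra rx with disjoint a x in d
  ... | false = ∑ℕ-zero (allSubsets n) λ _ → refl
  ... | true  = begin
    ∑ℕ (allSubsets n) (λ z → ⟦ (a ∪ x) ≟B z ⟧ * isRank (suc k) z)  ≡⟨ ∑ℕ-allSubsets-δ n (a ∪ x) (isRank (suc k)) ⟩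
    isRank (suc k) (a ∪ x)                                            ≡⟨ cong ⟦_⟧ (dec-true (rank (a ∪ x) ≟ suc k) rank[a∪x]≡1+k) ⟩
    1                                                                 ∎
    where
    rank[a∪x]≡1+k : rank (a ∪ x) ≡ suc k
    rank[a∪x]≡1+k = trans (rank-∪-disjoint a x d) (cong₂ _+_ ra rx)

  Hρ-count-on-level : ∀ {n} k (x : Subset n) → rank x ≡ k → Hρ-count k x ≡ n ∸ k
  Hρ-count-on-level {n} k x rx = begin
    Hρ-count k x
      ≡⟨ ∑ℕ-filter (λ a → rank a ≟ 1) (allSubsets n) _ ⟩
    ∑ℕ (allSubsets n) (λ a → isRank 1 a * (L-count k a x + Lᵗ-count k a x))
      ≡⟨ ∑ℕ-cong (allSubsets n) atom-term ⟩
    disjointAtoms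
      ≡⟨ m+n∸n≡m disjointAtoms (rank x) ⟨
    disjointAtoms + rank x ∸ rank x
      ≡⟨ cong₂ _∸_ (∑ℕ-disjoint-atoms+rank≡n n x) rx ⟩
    n ∸ k ∎
    where
    disjointAtoms = ∑ℕ (allSubsets n) (λ a → isRank 1 a * ⟦ disjoint a x ⟧)
    atom-term : ∀ a → isRank 1 a * (L-count k a x + Lᵗ-count k a x) ≡ isRank 1 a * ⟦ disjoint a x ⟧
    atom-term a = ⟦does⟧*-cong (rank a ≟ 1) λ ra →
      cong₂ _+_ (L-count-on-level k a x rx) (Lᵗ-count-on-level k a x ra rx)

  ∑ℕ-level-Hρ-count : ∀ n k → ∑ℕ (allSubsets n) (λ x → isRank k x * Hρ-count k x) ≡ length (level n k) * (n ∸ k)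
  ∑ℕ-level-Hρ-count n k = begin
    ∑ℕ (allSubsets n) (λ x → isRank k x * Hρ-count k x)  ≡⟨ ∑ℕ-cong (allSubsets n) on-level ⟩
    ∑ℕ (allSubsets n) (λ x → isRank k x * (n ∸ k))       ≡⟨ ∑ℕ-*ʳ (allSubsets n) (isRank k) (n ∸ k) ⟩
    ∑ℕ (allSubsets n) (isRank k) * (n ∸ k)               ≡⟨ cong (_* (n ∸ k)) (length-level≡∑ℕ n k) ⟨
    length (level n k) * (n ∸ k)                         ∎
    where
    on-level : ∀ x → isRank k x * Hρ-count k x ≡ isRank k x * (n ∸ k)
    on-level x = ⟦does⟧*-cong (rank x ≟ k) (Hρ-count-on-level k x)

  ∑ℕ-isRank≡C : ∀ n k → ∑ℕ (allSubsets n) (isRank k) ≡ n C k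
  ∑ℕ-isRank≡C zero    zero    = refl
  ∑ℕ-isRank≡C zero    (suc k) = refl
  ∑ℕ-isRank≡C (suc n) zero    = trans (∑ℕ-allSubsets-suc n _)
    (cong₂ _+_ (∑ℕ-zero (allSubsets n) λ _ → refl) (∑ℕ-isRank≡C n 0))
  ∑ℕ-isRank≡C (suc n) (suc k) = trans (∑ℕ-allSubsets-suc n _)
    (trans (cong₂ _+_ (∑ℕ-isRank≡C n k) (∑ℕ-isRank≡C n (suc k))) (nCk+nC[k+1]≡[n+1]C[k+1] n k))

  -- (k + 1) C(n, k + 1) = (n − k) C(n, k), kept free of truncated subtraction for the induction.
  C-absorption : ∀ n k → suc k * (n C suc k) + k * (n C k) ≡ n * (n C k)
  C-absorption zero    zero    = refl
  C-absorption zero    (suc k) = cong₂ _+_ (*-zeroʳ (suc (suc k))) (*-zeroʳ (suc k))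
  C-absorption (suc n) zero    =
    trans (cong (λ m → 1 * m + 0) (nC1≡n (suc n))) (trans (+-identityʳ _) (*-comm 1 (suc n)))
  C-absorption (suc n) (suc k) = begin
    suc (suc k) * (suc n C suc (suc k)) + suc k * (suc n C suc k)
      ≡⟨ cong₂ (λ u v → suc (suc k) * u + suc k * v)
               (nCk+nC[k+1]≡[n+1]C[k+1] n (suc k)) (nCk+nC[k+1]≡[n+1]C[k+1] n k) ⟨
    suc (suc k) * (b + c) + suc k * (a + b)
      ≡⟨ expand k a b c ⟩
    (suc (suc k) * c + suc k * b) + (suc k * b + k * a) + (a + b)
      ≡⟨ cong₂ (λ u v → u + v + (a + b)) (C-absorption n (suc k)) (C-absorption n k) ⟩
    n * b + n * a + (a + b)
      ≡⟨ factor n a b ⟩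
    suc n * (a + b)
      ≡⟨ cong (suc n *_) (nCk+nC[k+1]≡[n+1]C[k+1] n k) ⟩
    suc n * (suc n C suc k) ∎
    where
    a = n C k
    b = n C suc k
    c = n C suc (suc k)
    expand : ∀ k a b c → suc (suc k) * (b + c) + suc k * (a + b)
                         ≡ (suc (suc k) * c + suc k * b) + (suc k * b + k * a) + (a + b)
    expand = solve-∀
    factor : ∀ n a b → n * b + n * a + (a + b) ≡ suc n * (a + b)
    factor = solve-∀

  C-absorption-∸ : ∀ n k → (n C k) * (n ∸ k) ≡ (n C suc k) * suc k
  C-absorption-∸ n k = begin
    (n C k) * (n ∸ k)                               ≡⟨ *-comm (n C k) (n ∸ k) ⟩
    (n ∸ k) * (n C k)                               ≡⟨ *-distribʳ-∸ (n C k) n k ⟩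
    n * (n C k) ∸ k * (n C k)                       ≡⟨ cong (_∸ k * (n C k)) (C-absorption n k) ⟨
    suc k * (n C suc k) + k * (n C k) ∸ k * (n C k) ≡⟨ m+n∸n≡m (suc k * (n C suc k)) (k * (n C k)) ⟩
    suc k * (n C suc k)                             ≡⟨ *-comm (suc k) (n C suc k) ⟩
    (n C suc k) * suc k                             ∎

  C-positive : ∀ {n k} → k ≤ n → 0 < n C k
  C-positive {k = zero}          _         = s≤s z≤n
  C-positive {suc n} {suc k} (s≤s k≤n) =
    subst (0 <_) (nCk+nC[k+1]≡[n+1]C[k+1] n k) (<-≤-trans (C-positive k≤n) (m≤m+n (n C k) _))

  length-level≡C : ∀ n k → length (level n k) ≡ n C k
  length-level≡C n k = trans (length-level≡∑ℕ n k) (∑ℕ-isRank≡C n k)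

  length-level-absorption : ∀ n k → length (level n k) * (n ∸ k) ≡ length (level n (suc k)) * suc k
  length-level-absorption n k = begin
    length (level n k) * (n ∸ k)        ≡⟨ cong (_* (n ∸ k)) (length-level≡C n k) ⟩
    (n C k) * (n ∸ k)                   ≡⟨ C-absorption-∸ n k ⟩
    (n C suc k) * suc k                 ≡⟨ cong (_* suc k) (length-level≡C n (suc k)) ⟨
    length (level n (suc k)) * suc k    ∎

  length-level-positive : ∀ {n k} → k ≤ n → 0 < length (level n k)
  length-level-positive {n} {k} k≤n = subst (0 <_) (sym (length-level≡C n k)) (C-positive k≤n)

open Counting

module OrderedFieldProperties {c ℓ₁ ℓ₂} (F : EuclideanField c ℓ₁ ℓ₂) where
  open EuclideanField F
  open IsTotalOrder isTotalOrder using (total; antisym; ≤-respˡ-≈; ≤-respʳ-≈)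
  open CommutativeSemigroupProperties *-commutativeSemigroup using (interchange)
  open SetoidReasoning setoid

  x≤x+y : ∀ x {y} → 0# ≤ y → x ≤ (x + y)
  x≤x+y x 0≤y = ≤-respˡ-≈ (+-identityˡ x) (≤-respʳ-≈ (+-comm _ _) (+-monoˡ-≤ x 0≤y))

  0≤1 : 0# ≤ 1#
  0≤1 with total 0# 1#
  ... | inj₁ 0≤1 = 0≤1
  ... | inj₂ 1≤0 = ≤-respʳ-≈ [-1][-1]≈1 (*-nonneg 0≤-1 0≤-1)
    where
    open RingProperties ring using (-1*x≈-x)
    open GroupProperties (AbelianGroup.group +-abelianGroup) using (⁻¹-involutive)
    0≤-1 : 0# ≤ (- 1#)
    0≤-1 = ≤-respˡ-≈ (-‿inverseʳ 1#) (≤-respʳ-≈ (+-identityˡ _) (+-monoˡ-≤ (- 1#) 1≤0))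
    [-1][-1]≈1 : - 1# * - 1# ≈ 1#
    [-1][-1]≈1 = trans (-1*x≈-x (- 1#)) (⁻¹-involutive 1#)

  nonneg-+-≈0ˡ : ∀ {x y} → 0# ≤ x → 0# ≤ y → x + y ≈ 0# → x ≈ 0#
  nonneg-+-≈0ˡ {x} 0≤x 0≤y x+y≈0 = antisym (≤-respʳ-≈ x+y≈0 (x≤x+y x 0≤y)) 0≤x

  ⁻¹-inverseˡ : ∀ x → ¬ x ≈ 0# → x ⁻¹ * x ≈ 1#
  ⁻¹-inverseˡ x x≉0 = trans (*-comm _ _) (⁻¹-inverse x x≉0)

  nonneg-square-injective : ∀ {x y} → 0# ≤ x → 0# ≤ y → ¬ x ≈ 0# → x * x ≈ y * y → x ≈ y
  nonneg-square-injective {x} {y} 0≤x 0≤y x≉0 x²≈y² = begin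
    x                       ≈⟨ *-identityʳ x ⟨
    x * 1#                  ≈⟨ *-congˡ (⁻¹-inverse (x + y) x+y≉0) ⟨
    x * (w * w ⁻¹)          ≈⟨ *-assoc x w (w ⁻¹) ⟨
    (x * w) * w ⁻¹          ≈⟨ *-congʳ xw≈yw ⟩
    (y * w) * w ⁻¹          ≈⟨ *-assoc y w (w ⁻¹) ⟩
    y * (w * w ⁻¹)          ≈⟨ *-congˡ (⁻¹-inverse (x + y) x+y≉0) ⟩
    y * 1#                  ≈⟨ *-identityʳ y ⟩
    y                       ∎
    where
    w = x + y
    x+y≉0 : ¬ w ≈ 0#
    x+y≉0 w≈0 = x≉0 (nonneg-+-≈0ˡ 0≤x 0≤y w≈0)
    xw≈yw : x * w ≈ y * w
    xw≈yw = begin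
      x * (x + y)       ≈⟨ distribˡ x x y ⟩
      x * x + x * y     ≈⟨ +-cong x²≈y² (*-comm x y) ⟩
      y * y + y * x     ≈⟨ distribˡ y y x ⟨
      y * (y + x)       ≈⟨ *-congˡ (+-comm y x) ⟩
      y * (x + y)       ∎

  √-≉0 : ∀ {a} → 0# ≤ a → ¬ a ≈ 0# → ¬ √ a ≈ 0#
  √-≉0 {a} 0≤a a≉0 √a≈0 = a≉0 (begin
    a             ≈⟨ √-square a 0≤a ⟨
    √ a * √ a     ≈⟨ *-congʳ √a≈0 ⟩
    0# * √ a      ≈⟨ zeroˡ (√ a) ⟩
    0#            ∎)

  √-quotient : ∀ {a b x y} → 0# ≤ a → 0# ≤ b → 0# ≤ x → 0# ≤ y → ¬ a ≈ 0# → ¬ b ≈ 0# → ¬ x ≈ 0# →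
               x * x ≈ (a * b) * y → (√ a ⁻¹ * √ b ⁻¹) * x ≈ √ y
  √-quotient {a} {b} {x} {y} 0≤a 0≤b 0≤x 0≤y a≉0 b≉0 x≉0 x²≈aby = begin
    (√ a ⁻¹ * √ b ⁻¹) * x                       ≈⟨ *-congˡ x≈√a√b√y ⟩
    (√ a ⁻¹ * √ b ⁻¹) * ((√ a * √ b) * √ y)     ≈⟨ *-assoc _ _ _ ⟨
    ((√ a ⁻¹ * √ b ⁻¹) * (√ a * √ b)) * √ y     ≈⟨ *-congʳ (interchange _ _ _ _) ⟩
    ((√ a ⁻¹ * √ a) * (√ b ⁻¹ * √ b)) * √ y     ≈⟨ *-congʳ (*-cong (⁻¹-inverseˡ _ (√-≉0 0≤a a≉0)) (⁻¹-inverseˡ _ (√-≉0 0≤b b≉0))) ⟩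
    (1# * 1#) * √ y                             ≈⟨ *-congʳ (*-identityˡ 1#) ⟩
    1# * √ y                                    ≈⟨ *-identityˡ (√ y) ⟩
    √ y                                         ∎
    where
    x≈√a√b√y : x ≈ (√ a * √ b) * √ y
    x≈√a√b√y = nonneg-square-injective 0≤x (*-nonneg (*-nonneg (√-nonneg a) (√-nonneg b)) (√-nonneg y)) x≉0 (begin
      x * x                                         ≈⟨ x²≈aby ⟩
      (a * b) * y                                   ≈⟨ *-cong (*-cong (√-square a 0≤a) (√-square b 0≤b)) (√-square y 0≤y) ⟨
      ((√ a * √ a) * (√ b * √ b)) * (√ y * √ y)     ≈⟨ *-congʳ (interchange _ _ _ _) ⟩
      ((√ a * √ b) * (√ a * √ b)) * (√ y * √ y)     ≈⟨ interchange _ _ _ _ ⟩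
      ((√ a * √ b) * √ y) * ((√ a * √ b) * √ y)     ∎)

module RadialCompression {c ℓ₁ ℓ₂} (F : EuclideanField c ℓ₁ ℓ₂) (n : ℕ) where
  open EuclideanField F
  open LatticeHamiltonian F n
  open OrderedFieldProperties F
  open IsTotalOrder isTotalOrder using () renaming (refl to ≤-refl; trans to ≤-trans)
  open CommutativeSemigroupProperties *-commutativeSemigroup using (interchange; x∙yz≈y∙xz)
  open SetoidReasoning setoid

  fromℕ-+ : ∀ a b → fromℕ (a ℕ.+ b) ≈ fromℕ a + fromℕ b
  fromℕ-+ zero    b = sym (+-identityˡ _)
  fromℕ-+ (suc a) b = trans (+-congˡ (fromℕ-+ a b)) (sym (+-assoc _ _ _))

  fromℕ-* : ∀ a b → fromℕ (a ℕ.* b) ≈ fromℕ a * fromℕ b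
  fromℕ-* zero    b = sym (zeroˡ _)
  fromℕ-* (suc a) b = begin
    fromℕ (b ℕ.+ a ℕ.* b)           ≈⟨ fromℕ-+ b (a ℕ.* b) ⟩
    fromℕ b + fromℕ (a ℕ.* b)       ≈⟨ +-cong (sym (*-identityˡ _)) (fromℕ-* a b) ⟩
    1# * fromℕ b + fromℕ a * fromℕ b ≈⟨ distribʳ _ _ _ ⟨
    (1# + fromℕ a) * fromℕ b        ∎

  fromℕ-nonneg : ∀ m → 0# ≤ fromℕ m
  fromℕ-nonneg zero    = ≤-refl
  fromℕ-nonneg (suc m) = ≤-trans 0≤1 (x≤x+y 1# (fromℕ-nonneg m))

  fromℕ-≉0 : ∀ {m} → 0 < m → ¬ fromℕ m ≈ 0#
  fromℕ-≉0 {suc m} _ 1+m≈0 = 0≉1 (sym (nonneg-+-≈0ˡ 0≤1 (fromℕ-nonneg m) 1+m≈0))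

  fromℕ-⟦⟧ : ∀ b → (if b then 1# else 0#) ≈ fromℕ ⟦ b ⟧
  fromℕ-⟦⟧ true  = sym (+-identityʳ 1#)
  fromℕ-⟦⟧ false = refl

  sumV-apply : ∀ xs (f : Subset n → Vect) y → sumV xs f y ≈ Σ[ xs ] (λ a → f a y)
  sumV-apply []       f y = refl
  sumV-apply (x ∷ xs) f y = +-congˡ (sumV-apply xs f y)

  Σ-scaled-fromℕ : ∀ xs s (f : Subset n → ℕ) {g : Subset n → Carrier} →
                   (∀ x → g x ≈ s * fromℕ (f x)) → Σ[ xs ] g ≈ s * fromℕ (∑ℕ xs f)
  Σ-scaled-fromℕ []       s f g≈sf = sym (zeroʳ s)
  Σ-scaled-fromℕ (x ∷ xs) s f g≈sf = begin
    _ + Σ[ xs ] _                          ≈⟨ +-cong (g≈sf x) (Σ-scaled-fromℕ xs s f g≈sf) ⟩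
    s * fromℕ (f x) + s * fromℕ (∑ℕ xs f)  ≈⟨ distribˡ s _ _ ⟨
    s * (fromℕ (f x) + fromℕ (∑ℕ xs f))    ≈⟨ *-congˡ (fromℕ-+ (f x) _) ⟨
    s * fromℕ (f x ℕ.+ ∑ℕ xs f)            ∎

  ρ-scale : ℕ → Carrier
  ρ-scale j = √ (fromℕ (nₖ j)) ⁻¹

  ρ-apply : ∀ j x → ρ j x ≈ ρ-scale j * fromℕ (isRank j x)
  ρ-apply j x = *-congˡ (begin
    sumV (level n j) e x                                  ≈⟨ sumV-apply (level n j) e x ⟩
    Σ[ level n j ] (λ a → e a x)                          ≈⟨ Σ-scaled-fromℕ (level n j) 1# _ e≈1*⟦≟B⟧ ⟩
    1# * fromℕ (∑ℕ (level n j) (λ a → ⟦ a ≟B x ⟧))        ≈⟨ *-identityˡ _ ⟩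
    fromℕ (∑ℕ (level n j) (λ a → ⟦ a ≟B x ⟧))             ≡⟨ ≡.cong fromℕ (∑ℕ-level-δ n j x) ⟩
    fromℕ (isRank j x)                                    ∎)
    where
    e≈1*⟦≟B⟧ : ∀ a → e a x ≈ 1# * fromℕ ⟦ a ≟B x ⟧
    e≈1*⟦≟B⟧ a = trans (fromℕ-⟦⟧ (a ≟B x)) (sym (*-identityˡ _))

  diamond-ρ : ∀ j a x z y → diamond a x z * ρ j y ≈ ρ-scale j * fromℕ (⟦ disjoint a x ∧ ((a ∪ x) ≟B z) ⟧ ℕ.* isRank j y)
  diamond-ρ j a x z y = begin
    diamond a x z * ρ j y                          ≈⟨ *-cong (fromℕ-⟦⟧ _) (ρ-apply j y) ⟩
    fromℕ δ * (ρ-scale j * fromℕ (isRank j y))     ≈⟨ x∙yz≈y∙xz _ _ _ ⟩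
    ρ-scale j * (fromℕ δ * fromℕ (isRank j y))     ≈⟨ *-congˡ (fromℕ-* δ _) ⟨
    ρ-scale j * fromℕ (δ ℕ.* isRank j y)           ∎
    where δ = ⟦ disjoint a x ∧ ((a ∪ x) ≟B z) ⟧

  L-apply : ∀ k a x → L a (ρ (suc k)) x ≈ ρ-scale (suc k) * fromℕ (L-count k a x)
  L-apply k a x = Σ-scaled-fromℕ (allSubsets n) _ _ λ y → diamond-ρ (suc k) a y x y

  Lᵗ-apply : ∀ k a x → Lᵗ a (ρ (suc k)) x ≈ ρ-scale (suc k) * fromℕ (Lᵗ-count k a x)
  Lᵗ-apply k a x = Σ-scaled-fromℕ (allSubsets n) _ _ λ z → diamond-ρ (suc k) a x z z

  Hρ-apply : ∀ k x → H (ρ (suc k)) x ≈ (half * ρ-scale (suc k)) * fromℕ (Hρ-count k x)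
  Hρ-apply k x = trans (sumV-apply (atoms n) _ x) (Σ-scaled-fromℕ (atoms n) _ _ λ a → begin
    half * (L a (ρ (suc k)) x + Lᵗ a (ρ (suc k)) x)     ≈⟨ *-congˡ (+-cong (L-apply k a x) (Lᵗ-apply k a x)) ⟩
    half * (s * fromℕ (L-count k a x) + s * fromℕ (Lᵗ-count k a x))
                                                        ≈⟨ *-congˡ (distribˡ s _ _) ⟨
    half * (s * (fromℕ (L-count k a x) + fromℕ (Lᵗ-count k a x)))
                                                        ≈⟨ *-assoc half s _ ⟨
    (half * s) * (fromℕ (L-count k a x) + fromℕ (Lᵗ-count k a x))
                                                        ≈⟨ *-congˡ (fromℕ-+ (L-count k a x) _) ⟨
    (half * s) * fromℕ (L-count k a x ℕ.+ Lᵗ-count k a x) ∎)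
    where s = ρ-scale (suc k)

  β-count : ∀ k → β k ≈ (ρ-scale k * (half * ρ-scale (suc k))) * fromℕ (nₖ k ℕ.* (n ∸ k))
  β-count k = begin
    Σ[ allSubsets n ] (λ x → ρ k x * H (ρ (suc k)) x)                      ≈⟨ Σ-scaled-fromℕ (allSubsets n) s _ term ⟩
    s * fromℕ (∑ℕ (allSubsets n) (λ x → isRank k x ℕ.* Hρ-count k x))     ≡⟨ ≡.cong (λ m → s * fromℕ m) (∑ℕ-level-Hρ-count n k) ⟩
    s * fromℕ (nₖ k ℕ.* (n ∸ k))                                          ∎
    where
    s = ρ-scale k * (half * ρ-scale (suc k))
    term : ∀ x → ρ k x * H (ρ (suc k)) x ≈ s * fromℕ (isRank k x ℕ.* Hρ-count k x)
    term x = begin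
      ρ k x * H (ρ (suc k)) x                                                        ≈⟨ *-cong (ρ-apply k x) (Hρ-apply k x) ⟩
      (ρ-scale k * fromℕ (isRank k x)) * ((half * ρ-scale (suc k)) * fromℕ (Hρ-count k x)) ≈⟨ interchange _ _ _ _ ⟩
      s * (fromℕ (isRank k x) * fromℕ (Hρ-count k x))                                ≈⟨ *-congˡ (fromℕ-* (isRank k x) _) ⟨
      s * fromℕ (isRank k x ℕ.* Hρ-count k x)                                        ∎

  normalised-cover-count : ∀ k → k < n →
    (ρ-scale k * ρ-scale (suc k)) * fromℕ (nₖ k ℕ.* (n ∸ k)) ≈ √ (fromℕ (suc k ℕ.* (n ∸ k)))
  normalised-cover-count k k<n = √-quotient
    (fromℕ-nonneg (nₖ k)) (fromℕ-nonneg (nₖ (suc k))) (fromℕ-nonneg N) (fromℕ-nonneg (suc k ℕ.* (n ∸ k)))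
    (fromℕ-≉0 0<nₖ) (fromℕ-≉0 0<nₖ₊₁) (fromℕ-≉0 0<N) (begin
      fromℕ N * fromℕ N                                              ≈⟨ fromℕ-* N N ⟨
      fromℕ (N ℕ.* N)                                                ≡⟨ ≡.cong (λ m → fromℕ (N ℕ.* m)) (length-level-absorption n k) ⟩
      fromℕ (N ℕ.* (nₖ (suc k) ℕ.* suc k))                           ≡⟨ ≡.cong fromℕ (regroup (nₖ k) (n ∸ k) (nₖ (suc k)) (suc k)) ⟩
      fromℕ ((nₖ k ℕ.* nₖ (suc k)) ℕ.* (suc k ℕ.* (n ∸ k)))          ≈⟨ fromℕ-* (nₖ k ℕ.* nₖ (suc k)) _ ⟩
      fromℕ (nₖ k ℕ.* nₖ (suc k)) * fromℕ (suc k ℕ.* (n ∸ k))        ≈⟨ *-congʳ (fromℕ-* (nₖ k) _) ⟩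
      (fromℕ (nₖ k) * fromℕ (nₖ (suc k))) * fromℕ (suc k ℕ.* (n ∸ k)) ∎)
    where
    N = nₖ k ℕ.* (n ∸ k)
    0<nₖ : 0 < nₖ k
    0<nₖ = length-level-positive (ℕ.<⇒≤ k<n)
    0<nₖ₊₁ : 0 < nₖ (suc k)
    0<nₖ₊₁ = length-level-positive k<n
    0<N : 0 < N
    0<N = ℕ.*-mono-≤ 0<nₖ (ℕ.m<n⇒0<n∸m k<n)
    regroup : ∀ a m b p → (a ℕ.* m) ℕ.* (b ℕ.* p) ≡.≡ (a ℕ.* b) ℕ.* (p ℕ.* m)
    regroup = solve-∀

proposition5p2 : ∀ {c ℓ₁ ℓ₂ : Level} (F : EuclideanField c ℓ₁ ℓ₂) (n k : ℕ) → k < n →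
    let open EuclideanField F
        open LatticeHamiltonian F n
    in β k ≈ (half * √ (fromℕ (suc k ℕ.* (n ∸ k))))
proposition5p2 F n k k<n = begin
  β k                                                                ≈⟨ β-count k ⟩
  (ρ-scale k * (half * ρ-scale (suc k))) * fromℕ (nₖ k ℕ.* (n ∸ k))  ≈⟨ *-congʳ (x∙yz≈y∙xz _ _ _) ⟩
  (half * (ρ-scale k * ρ-scale (suc k))) * fromℕ (nₖ k ℕ.* (n ∸ k))  ≈⟨ *-assoc _ _ _ ⟩
  half * ((ρ-scale k * ρ-scale (suc k)) * fromℕ (nₖ k ℕ.* (n ∸ k)))  ≈⟨ *-congˡ (normalised-cover-count k k<n) ⟩
  half * √ (fromℕ (suc k ℕ.* (n ∸ k)))                               ∎
  where
  open EuclideanField F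
  open LatticeHamiltonian F n
  open RadialCompression F n
  open CommutativeSemigroupProperties *-commutativeSemigroup using (x∙yz≈y∙xz)
  open SetoidReasoning setoid
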